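{- For a simple connected finite graph $G$, $h(T(G))>|E(G)|$ if and only if $G$ has some internal vertex.
   Context: An internal vertex of $G$ is a vertex of degree at least $2$ (i.e. adjacent to at least two vertices). The total graph $T(G)$ has vertex set $V(G)\cup E(G)$, two elements being adjacent in $T(G)$ if and only if they are adjacent or incident in $G$ (two vertices adjacent in $G$, two edges sharing an endpoint, or a vertex and an edge incident to it). The primitive hole number $h(H)$ of a graph $H$ is the number of triangles (cycles $C_3$) in $H$, with $h(H)=0$ if there are none. -}

module Defs where

open import Data.Nat using (ℕ; zero; suc; _≤_; _<_)
open import Data.Fin using (Fin; toℕ)
open import Data.Fin.Properties using () renaming (_≟_ to _≟ᶠ_)
open import Data.Bool using (Bool; true; false; _∧_; _∨_; not; T)
open import Data.List using (List; []; _∷_; _++_; map; filter; length; allFin; concatMap)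
open import Data.Product using (_×_; _,_; Σ; ∃-syntax)
open import Data.Sum using (_⊎_; inj₁; inj₂)
open import Relation.Nullary.Decidable using (⌊_⌋; does)
open import Relation.Binary.PropositionalEquality using (_≡_)
open import Data.Nat.Properties using (_<?_)

record Graph (n : ℕ) : Set where
  field
    adj   : Fin n → Fin n → Bool
    sym   : ∀ u v → adj u v ≡ adj v u
    irrefl : ∀ u → adj u u ≡ false
open Graph public

_==_ : ∀ {n} → Fin n → Fin n → Bool
u == v = ⌊ u ≟ᶠ v ⌋

data Reach {n : ℕ} (G : Graph n) : Fin n → Fin n → Set where
  here : ∀ {u} → Reach G u u
  step : ∀ {u w v} → T (adj G u w) → Reach G w v → Reach G u v

Connected : ∀ {n} → Graph n → Set
Connected G = ∀ u v → Reach G u v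

count : ∀ {A : Set} → (A → Bool) → List A → ℕ
count p [] = 0
count p (x ∷ xs) with p x
... | true  = suc (count p xs)
... | false = count p xs

degree : ∀ {n} → Graph n → Fin n → ℕ
degree G u = count (adj G u) (allFin _)

Internal : ∀ {n} → Graph n → Fin n → Set
Internal G u = 2 ≤ degree G u

pairs : ∀ n → List (Fin n × Fin n)
pairs n = concatMap (λ i → map (λ j → (i , j)) (allFin n)) (allFin n)

-- The edge set E(G): each edge {i,j} listed once as (i , j) with i < j.
edges : ∀ {n} → Graph n → List (Fin n × Fin n)
edges {n} G = filter (λ e → (toℕ (Data.Product.proj₁ e) <? toℕ (Data.Product.proj₂ e))
                              Relation.Nullary.Decidable.×-dec
                            (adj G (Data.Product.proj₁ e) (Data.Product.proj₂ e) Data.Bool.≟ true))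
                     (pairs n)
  where import Data.Product
        import Relation.Nullary.Decidable
        import Data.Bool

-- Elements of the total graph T(G): vertices and edges of G
TElem : ℕ → Set
TElem n = Fin n ⊎ (Fin n × Fin n)

TVertices : ∀ {n} → Graph n → List (TElem n)
TVertices {n} G = map inj₁ (allFin n) ++ map inj₂ (edges G)

TAdj : ∀ {n} → Graph n → TElem n → TElem n → Bool
TAdj G (inj₁ u) (inj₁ v) = adj G u v
TAdj G (inj₁ u) (inj₂ (a , b)) = (u == a) ∨ (u == b)
TAdj G (inj₂ (a , b)) (inj₁ u) = (u == a) ∨ (u == b)
TAdj G (inj₂ (a , b)) (inj₂ (c , d)) =
  not ((a == c) ∧ (b == d)) ∧ ((a == c) ∨ (a == d) ∨ (b == c) ∨ (b == d))

triples : ∀ {A : Set} → List A → List (A × A × A)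
pairsAfter : ∀ {A : Set} → A → List A → List (A × A × A)
pairsAfter x [] = []
pairsAfter x (y ∷ ys) = map (λ z → (x , y , z)) ys ++ pairsAfter x ys
triples [] = []
triples (x ∷ xs) = pairsAfter x xs ++ triples xs

-- primitive hole number of a graph given by a duplicate-free vertex list and
-- an adjacency relation: the number of triangles (3-subsets pairwise adjacent)
holeNumber : ∀ {A : Set} → List A → (A → A → Bool) → ℕ
holeNumber vs R = count (λ { (x , y , z) → R x y ∧ R y z ∧ R x z }) (triples vs)

hT : ∀ {n} → Graph n → ℕ
hT G = holeNumber (TVertices G) (TAdj G)

numEdges : ∀ {n} → Graph n → ℕ
numEdges G = length (edges G)

module Submission where

-- The vertex list of T(G) is V ++ E, the vertices of G followed by its edges,
-- so every triangle of T(G) has three, two, one or no corners in V: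
--     h(T(G)) = #VVV + #VVE + #VEE + #EEE.
-- Two vertices a, b and an edge cd form a triangle iff {a , b} = {c , d}, so
-- every edge lies in exactly one VVE-triangle and #VVE = |E(G)|.  Hence
-- h(T(G)) > |E(G)| iff #VVV, #VEE or #EEE is positive.  A triangle of G or two
-- adjacent edges of G (present in every VEE- and EEE-triangle) yield a vertex
-- with two distinct neighbours, i.e. an internal vertex; conversely an internal
-- vertex u with neighbours v ≠ w yields the VEE-triangle {u , uv , uw}.

open import Defs renaming (sym to adj-sym)
open import Data.Nat using (ℕ; zero; suc; _+_; _*_; _≤_; _<_; z≤n; s≤s)
open import Data.Nat.Properties
  using ( ≤-refl; ≤-trans; <-≤-trans; ≤-pred; <-irrefl; <-asym; <-cmp; _<?_; m≤m+n; m≤n+m; m<m+n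
        ; +-mono-≤; +-monoˡ-≤; +-assoc; +-identityʳ; *-zeroʳ; *-identityʳ; *-distribˡ-+; *-cancelˡ-≡
        ; +-commutativeSemigroup )
open import Data.Nat.Solver using (module +-*-Solver)
open import Algebra.Properties.CommutativeSemigroup +-commutativeSemigroup using (interchange)
open import Data.Bool using (Bool; true; false; T; not; _∧_; _∨_) renaming (_≟_ to _≟ᵇ_)
open import Data.Bool.Properties using (T-≡; ∧-zeroʳ; ∧-comm)
open import Data.Fin using (Fin; toℕ) renaming (zero to fzero; suc to fsuc)
open import Data.Fin.Properties using (toℕ-injective) renaming (_≟_ to _≟ᶠ_)
open import Data.List using (List; []; _∷_; _++_; map; length; allFin)
open import Data.List.Properties using (map-++; map-∘; map-tabulate)
open import Data.List.Membership.Propositional using (_∈_; lose)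
open import Data.List.Membership.Propositional.Properties
  using (∈-map⁺; ∈-map⁻; ∈-++⁺ˡ; ∈-++⁺ʳ; ∈-++⁻; ∈-filter⁺; ∈-filter⁻; ∈-concatMap⁺; ∈-allFin)
open import Data.List.Relation.Unary.Any using (here; there)
import Data.List.Relation.Unary.All as All
open import Data.List.Relation.Unary.AllPairs using (_∷_)
open import Data.List.Relation.Unary.Unique.Propositional using (Unique)
open import Data.List.Relation.Unary.Unique.Propositional.Properties using (allFin⁺)
open import Data.Product using (_×_; _,_; proj₁; proj₂; ∃; ∃-syntax)
open import Data.Sum using (_⊎_; inj₁; inj₂) renaming (map to map-⊎)
open import Data.Empty using (⊥-elim)
open import Function using (id)
open import Function.Bundles using (Equivalence; _⇔_; mk⇔)
open import Relation.Nullary using (Dec; yes; no; ¬_)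
open import Relation.Nullary.Decidable using (toWitness; fromWitness; _×-dec_)
open import Relation.Binary.Definitions using (tri<; tri≈; tri>)
open import Relation.Binary.PropositionalEquality
open +-*-Solver
open ≡-Reasoning

∑ : ∀ {A : Set} → (A → ℕ) → List A → ℕ
∑ f [] = 0
∑ f (x ∷ xs) = f x + ∑ f xs

𝟙 : Bool → ℕ
𝟙 true = 1
𝟙 false = 0

𝟙-positive : ∀ {b} → 0 < 𝟙 b → T b
𝟙-positive {true} _ = _

𝟙-true : ∀ {b} → T b → 1 ≤ 𝟙 b
𝟙-true {true} _ = ≤-refl

count≡∑𝟙 : ∀ {A : Set} (p : A → Bool) xs → count p xs ≡ ∑ (λ x → 𝟙 (p x)) xs
count≡∑𝟙 p [] = refl
count≡∑𝟙 p (x ∷ xs) with p x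
... | true = cong suc (count≡∑𝟙 p xs)
... | false = count≡∑𝟙 p xs

∑-zero : ∀ {A : Set} (xs : List A) → ∑ (λ _ → 0) xs ≡ 0
∑-zero [] = refl
∑-zero (x ∷ xs) = ∑-zero xs

∑-one : ∀ {A : Set} (xs : List A) → ∑ (λ _ → 1) xs ≡ length xs
∑-one [] = refl
∑-one (x ∷ xs) = cong suc (∑-one xs)

∑-cong : ∀ {A : Set} {f g : A → ℕ} xs → (∀ x → x ∈ xs → f x ≡ g x) → ∑ f xs ≡ ∑ g xs
∑-cong [] eq = refl
∑-cong (x ∷ xs) eq = cong₂ _+_ (eq x (here refl)) (∑-cong xs (λ y y∈xs → eq y (there y∈xs)))

∑-++ : ∀ {A : Set} (f : A → ℕ) xs ys → ∑ f (xs ++ ys) ≡ ∑ f xs + ∑ f ys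
∑-++ f [] ys = refl
∑-++ f (x ∷ xs) ys = trans (cong (f x +_) (∑-++ f xs ys)) (sym (+-assoc (f x) _ _))

∑-map : ∀ {A B : Set} (f : B → ℕ) (g : A → B) xs → ∑ f (map g xs) ≡ ∑ (λ x → f (g x)) xs
∑-map f g [] = refl
∑-map f g (x ∷ xs) = cong (f (g x) +_) (∑-map f g xs)

∑-+ : ∀ {A : Set} (f g : A → ℕ) xs → ∑ (λ x → f x + g x) xs ≡ ∑ f xs + ∑ g xs
∑-+ f g [] = refl
∑-+ f g (x ∷ xs) = trans (cong (f x + g x +_) (∑-+ f g xs)) (interchange (f x) (g x) (∑ f xs) (∑ g xs))

∑-* : ∀ {A : Set} (k : ℕ) (f : A → ℕ) xs → ∑ (λ x → k * f x) xs ≡ k * ∑ f xs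
∑-* k f [] = sym (*-zeroʳ k)
∑-* k f (x ∷ xs) = trans (cong (k * f x +_) (∑-* k f xs)) (sym (*-distribˡ-+ k (f x) (∑ f xs)))

∑-swap : ∀ {A B : Set} (f : A → B → ℕ) xs ys →
  ∑ (λ x → ∑ (f x) ys) xs ≡ ∑ (λ y → ∑ (λ x → f x y) xs) ys
∑-swap f [] ys = sym (∑-zero ys)
∑-swap f (x ∷ xs) ys =
  trans (cong (∑ (f x) ys +_) (∑-swap f xs ys)) (sym (∑-+ (f x) (λ y → ∑ (λ x' → f x' y) xs) ys))

∑-≥-term : ∀ {A : Set} (f : A → ℕ) {x xs} → x ∈ xs → f x ≤ ∑ f xs
∑-≥-term f {xs = y ∷ ys} (here refl) = m≤m+n (f y) (∑ f ys)
∑-≥-term f {xs = y ∷ ys} (there x∈ys) = ≤-trans (∑-≥-term f x∈ys) (m≤n+m (∑ f ys) (f y))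

∑-positive : ∀ {A : Set} (f : A → ℕ) xs → 0 < ∑ f xs → ∃ λ x → x ∈ xs × 0 < f x
∑-positive f (x ∷ xs) pos with f x in eq
... | zero = let (y , y∈xs , fy>0) = ∑-positive f xs pos in y , there y∈xs , fy>0
... | suc _ = x , here refl , subst (0 <_) (sym eq) (s≤s z≤n)

∑𝟙-≥2 : ∀ {A : Set} (p : A → Bool) {x y} xs → x ∈ xs → y ∈ xs → x ≢ y → T (p x) → T (p y) →
  2 ≤ ∑ (λ z → 𝟙 (p z)) xs
∑𝟙-≥2 p (z ∷ xs) (here refl) (here refl) x≢y _ _ = ⊥-elim (x≢y refl)
∑𝟙-≥2 p {y = y} (z ∷ xs) (here refl) (there y∈xs) _ pz py =
  +-mono-≤ (𝟙-true pz) (≤-trans (𝟙-true py) (∑-≥-term (λ w → 𝟙 (p w)) y∈xs))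
∑𝟙-≥2 p {x = x} (z ∷ xs) (there x∈xs) (here refl) _ px pz =
  +-mono-≤ (𝟙-true pz) (≤-trans (𝟙-true px) (∑-≥-term (λ w → 𝟙 (p w)) x∈xs))
∑𝟙-≥2 p (z ∷ xs) (there x∈xs) (there y∈xs) x≢y px py =
  ≤-trans (∑𝟙-≥2 p xs x∈xs y∈xs x≢y px py) (m≤n+m _ _)

∑𝟙-≥2-witnesses : ∀ {A : Set} (p : A → Bool) xs → Unique xs → 2 ≤ ∑ (λ z → 𝟙 (p z)) xs →
  ∃ λ x → ∃ λ y → x ≢ y × T (p x) × T (p y)
∑𝟙-≥2-witnesses p (z ∷ xs) (z∉xs ∷ unique) two with p z in pz
... | true = let (y , y∈xs , py) = ∑-positive (λ w → 𝟙 (p w)) xs (≤-pred two)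
             in z , y , All.lookup z∉xs y∈xs , subst T (sym pz) _ , 𝟙-positive py
... | false = ∑𝟙-≥2-witnesses p xs unique two

choose2 : ∀ {A : Set} → List A → List (A × A)
choose2 [] = []
choose2 (y ∷ ys) = map (y ,_) ys ++ choose2 ys

pairsAfter≡map : ∀ {A : Set} (x : A) ys → pairsAfter x ys ≡ map (x ,_) (choose2 ys)
pairsAfter≡map x [] = refl
pairsAfter≡map x (y ∷ ys) = begin
  map (λ z → x , y , z) ys ++ pairsAfter x ys          ≡⟨ cong₂ _++_ (map-∘ ys) (pairsAfter≡map x ys) ⟩
  map (x ,_) (map (y ,_) ys) ++ map (x ,_) (choose2 ys) ≡⟨ map-++ (x ,_) (map (y ,_) ys) (choose2 ys) ⟨
  map (x ,_) (choose2 (y ∷ ys))                         ∎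

∑-choose2-∷ : ∀ {A : Set} (g : A × A → ℕ) x xs →
  ∑ g (choose2 (x ∷ xs)) ≡ ∑ (λ y → g (x , y)) xs + ∑ g (choose2 xs)
∑-choose2-∷ g x xs = trans (∑-++ g (map (x ,_) xs) (choose2 xs)) (cong (_+ ∑ g (choose2 xs)) (∑-map g (x ,_) xs))

∑-triples-∷ : ∀ {A : Set} (f : A × A × A → ℕ) x xs →
  ∑ f (triples (x ∷ xs)) ≡ ∑ (λ p → f (x , p)) (choose2 xs) + ∑ f (triples xs)
∑-triples-∷ f x xs = begin
  ∑ f (pairsAfter x xs ++ triples xs)                   ≡⟨ ∑-++ f (pairsAfter x xs) (triples xs) ⟩
  ∑ f (pairsAfter x xs) + ∑ f (triples xs)              ≡⟨ cong (λ l → ∑ f l + ∑ f (triples xs)) (pairsAfter≡map x xs) ⟩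
  ∑ f (map (x ,_) (choose2 xs)) + ∑ f (triples xs)      ≡⟨ cong (_+ ∑ f (triples xs)) (∑-map f (x ,_) (choose2 xs)) ⟩
  ∑ (λ p → f (x , p)) (choose2 xs) + ∑ f (triples xs)   ∎

∑-choose2-++ : ∀ {A : Set} (g : A × A → ℕ) xs ys →
  ∑ g (choose2 (xs ++ ys)) ≡ ∑ g (choose2 xs) + ∑ (λ x → ∑ (λ y → g (x , y)) ys) xs + ∑ g (choose2 ys)
∑-choose2-++ g [] ys = refl
∑-choose2-++ {A} g (x ∷ xs) ys = begin
  ∑ g (choose2 (x ∷ xs ++ ys))                            ≡⟨ ∑-choose2-∷ g x (xs ++ ys) ⟩
  ∑ gx (xs ++ ys) + ∑ g (choose2 (xs ++ ys))              ≡⟨ cong₂ _+_ (∑-++ gx xs ys) (∑-choose2-++ g xs ys) ⟩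
  (∑ gx xs + ∑ gx ys) + (∑ g (choose2 xs) + cross + ∑ g (choose2 ys))
    ≡⟨ solve 5 (λ a b c d e → (a :+ b) :+ (c :+ d :+ e) := (a :+ c) :+ (b :+ d) :+ e) refl
         (∑ gx xs) (∑ gx ys) (∑ g (choose2 xs)) cross (∑ g (choose2 ys)) ⟩
  (∑ gx xs + ∑ g (choose2 xs)) + (∑ gx ys + cross) + ∑ g (choose2 ys)
    ≡⟨ cong (λ k → k + (∑ gx ys + cross) + ∑ g (choose2 ys)) (∑-choose2-∷ g x xs) ⟨
  ∑ g (choose2 (x ∷ xs)) + (∑ gx ys + cross) + ∑ g (choose2 ys) ∎
  where
    gx : A → ℕ
    gx y = g (x , y)
    cross : ℕ
    cross = ∑ (λ x' → ∑ (λ y → g (x' , y)) ys) xs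

-- Sums over the 3-subsets of xs ++ ys with two elements from xs and one from
-- ys, respectively one from xs and two from ys.
∑₂₁ : ∀ {A : Set} → (A × A × A → ℕ) → List A → List A → ℕ
∑₂₁ f xs ys = ∑ (λ z → ∑ (λ p → f (proj₁ p , proj₂ p , z)) (choose2 xs)) ys

∑₁₂ : ∀ {A : Set} → (A × A × A → ℕ) → List A → List A → ℕ
∑₁₂ f xs ys = ∑ (λ x → ∑ (λ p → f (x , p)) (choose2 ys)) xs

∑₂₁-∷ : ∀ {A : Set} (f : A × A × A → ℕ) x xs ys →
  ∑₂₁ f (x ∷ xs) ys ≡ ∑ (λ w → ∑ (λ z → f (x , w , z)) ys) xs + ∑₂₁ f xs ys
∑₂₁-∷ {A} f x xs ys = begin
  ∑ (λ z → ∑ (fz z) (choose2 (x ∷ xs))) ys                             ≡⟨ ∑-cong ys (λ z _ → ∑-choose2-∷ (fz z) x xs) ⟩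
  ∑ (λ z → ∑ (λ w → f (x , w , z)) xs + ∑ (fz z) (choose2 xs)) ys      ≡⟨ ∑-+ (λ z → ∑ (λ w → f (x , w , z)) xs) (λ z → ∑ (fz z) (choose2 xs)) ys ⟩
  ∑ (λ z → ∑ (λ w → f (x , w , z)) xs) ys + ∑₂₁ f xs ys                ≡⟨ cong (_+ ∑₂₁ f xs ys) (∑-swap (λ w z → f (x , w , z)) xs ys) ⟨
  ∑ (λ w → ∑ (λ z → f (x , w , z)) ys) xs + ∑₂₁ f xs ys                ∎
  where
    fz : A → A × A → ℕ
    fz z p = f (proj₁ p , proj₂ p , z)

∑-triples-++ : ∀ {A : Set} (f : A × A × A → ℕ) xs ys →
  ∑ f (triples (xs ++ ys)) ≡ ∑ f (triples xs) + ∑₂₁ f xs ys + ∑₁₂ f xs ys + ∑ f (triples ys)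
∑-triples-++ f [] ys = cong (λ k → k + 0 + ∑ f (triples ys)) (sym (∑-zero ys))
∑-triples-++ {A} f (x ∷ xs) ys = begin
  ∑ f (triples (x ∷ xs ++ ys))                                   ≡⟨ ∑-triples-∷ f x (xs ++ ys) ⟩
  ∑ fx (choose2 (xs ++ ys)) + ∑ f (triples (xs ++ ys))           ≡⟨ cong₂ _+_ (∑-choose2-++ fx xs ys) (∑-triples-++ f xs ys) ⟩
  (∑ fx (choose2 xs) + xy + ∑ fx (choose2 ys)) + (∑ f (triples xs) + ∑₂₁ f xs ys + ∑₁₂ f xs ys + ∑ f (triples ys))
    ≡⟨ solve 7 (λ a b c d e g h → (a :+ b :+ c) :+ (d :+ e :+ g :+ h) := (a :+ d) :+ (b :+ e) :+ (c :+ g) :+ h) refl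
         (∑ fx (choose2 xs)) xy (∑ fx (choose2 ys)) (∑ f (triples xs)) (∑₂₁ f xs ys) (∑₁₂ f xs ys) (∑ f (triples ys)) ⟩
  (∑ fx (choose2 xs) + ∑ f (triples xs)) + (xy + ∑₂₁ f xs ys) + (∑ fx (choose2 ys) + ∑₁₂ f xs ys) + ∑ f (triples ys)
    ≡⟨ cong₂ (λ k l → k + l + ∑₁₂ f (x ∷ xs) ys + ∑ f (triples ys)) (∑-triples-∷ f x xs) (∑₂₁-∷ f x xs ys) ⟨
  ∑ f (triples (x ∷ xs)) + ∑₂₁ f (x ∷ xs) ys + ∑₁₂ f (x ∷ xs) ys + ∑ f (triples ys) ∎
  where
    fx : A × A → ℕ
    fx p = f (x , p)
    xy : ℕ
    xy = ∑ (λ w → ∑ (λ z → f (x , w , z)) ys) xs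

choose2-∈ : ∀ {A : Set} {x y : A} zs → (x , y) ∈ choose2 zs → x ∈ zs × y ∈ zs
choose2-∈ (z ∷ zs) xy∈ with ∈-++⁻ (map (z ,_) zs) xy∈
... | inj₁ xy∈map with ∈-map⁻ (z ,_) xy∈map
...   | _ , y∈zs , refl = here refl , there y∈zs
choose2-∈ (z ∷ zs) xy∈ | inj₂ xy∈rest =
  let (x∈zs , y∈zs) = choose2-∈ zs xy∈rest in there x∈zs , there y∈zs

triples-∈ : ∀ {A : Set} {x y z : A} ws → (x , y , z) ∈ triples ws → x ∈ ws × y ∈ ws × z ∈ ws
triples-∈ (w ∷ ws) xyz∈ with ∈-++⁻ (pairsAfter w ws) xyz∈
... | inj₁ xyz∈after with ∈-map⁻ (w ,_) (subst (_ ∈_) (pairsAfter≡map w ws) xyz∈after)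
...   | _ , yz∈ , refl = let (y∈ws , z∈ws) = choose2-∈ ws yz∈ in here refl , there y∈ws , there z∈ws
triples-∈ (w ∷ ws) xyz∈ | inj₂ xyz∈rest =
  let (x∈ws , y∈ws , z∈ws) = triples-∈ ws xyz∈rest in there x∈ws , there y∈ws , there z∈ws

choose2-complete : ∀ {A : Set} {x y : A} zs → x ∈ zs → y ∈ zs → x ≢ y →
  (x , y) ∈ choose2 zs ⊎ (y , x) ∈ choose2 zs
choose2-complete (z ∷ zs) (here refl) (here refl) x≢y = ⊥-elim (x≢y refl)
choose2-complete (z ∷ zs) (here refl) (there y∈zs) _ = inj₁ (∈-++⁺ˡ (∈-map⁺ (z ,_) y∈zs))
choose2-complete (z ∷ zs) (there x∈zs) (here refl) _ = inj₂ (∈-++⁺ˡ (∈-map⁺ (z ,_) x∈zs))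
choose2-complete (z ∷ zs) (there x∈zs) (there y∈zs) x≢y =
  map-⊎ (∈-++⁺ʳ _) (∈-++⁺ʳ _) (choose2-complete zs x∈zs y∈zs x≢y)

choose2-map : ∀ {A B : Set} (g : A → B) xs →
  choose2 (map g xs) ≡ map (λ p → g (proj₁ p) , g (proj₂ p)) (choose2 xs)
choose2-map g [] = refl
choose2-map {A} {B} g (x ∷ xs) = begin
  map (g x ,_) (map g xs) ++ choose2 (map g xs)  ≡⟨ cong₂ _++_ (sym (map-∘ xs)) (choose2-map g xs) ⟩
  map (λ y → g x , g y) xs ++ map g² (choose2 xs) ≡⟨ cong (_++ map g² (choose2 xs)) (map-∘ xs) ⟩
  map g² (map (x ,_) xs) ++ map g² (choose2 xs)  ≡⟨ map-++ g² (map (x ,_) xs) (choose2 xs) ⟨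
  map g² (choose2 (x ∷ xs))                      ∎
  where
    g² : A × A → B × B
    g² (a , b) = g a , g b

∑-choose2-symmetric : ∀ {A : Set} (g : A → A → ℕ) → (∀ x y → g x y ≡ g y x) → (∀ x → g x x ≡ 0) →
  ∀ xs → 2 * ∑ (λ p → g (proj₁ p) (proj₂ p)) (choose2 xs) ≡ ∑ (λ x → ∑ (g x) xs) xs
∑-choose2-symmetric g g-sym g-diag [] = refl
∑-choose2-symmetric {A} g g-sym g-diag (x ∷ xs) = begin
  2 * ∑ ĝ (choose2 (x ∷ xs))                            ≡⟨ cong (2 *_) (∑-choose2-∷ ĝ x xs) ⟩
  2 * (row + ∑ ĝ (choose2 xs))                          ≡⟨ *-distribˡ-+ 2 row _ ⟩
  2 * row + 2 * ∑ ĝ (choose2 xs)                        ≡⟨ cong (2 * row +_) (∑-choose2-symmetric g g-sym g-diag xs) ⟩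
  2 * row + rest                                        ≡⟨ solve 2 (λ r s → con 2 :* r :+ s := r :+ (r :+ s)) refl row rest ⟩
  row + (row + rest)                                    ≡⟨ cong₂ (λ d c → d + row + (c + rest)) (g-diag x) column ⟨
  (g x x + row) + (∑ (λ y → g y x) xs + rest)           ≡⟨ cong (g x x + row +_) (∑-+ (λ y → g y x) (λ y → ∑ (g y) xs) xs) ⟨
  ∑ (g x) (x ∷ xs) + ∑ (λ y → ∑ (g y) (x ∷ xs)) xs      ∎
  where
    ĝ : A × A → ℕ
    ĝ (a , b) = g a b
    row rest : ℕ
    row = ∑ (g x) xs
    rest = ∑ (λ y → ∑ (g y) xs) xs
    column : ∑ (λ y → g y x) xs ≡ row
    column = ∑-cong xs (λ y _ → g-sym y x)

T-not : ∀ {x} → T (not x) → ¬ T x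
T-not {false} _ ()

T-not⁺ : ∀ {x} → ¬ T x → T (not x)
T-not⁺ {true} ¬x = ¬x _
T-not⁺ {false} _ = _

-- Introduction and elimination rules for T of the Boolean connectives; the
-- left operand is explicit because it cannot be inferred from T (x ∧ y).
∧-intro : ∀ {x y} → T x → T y → T (x ∧ y)
∧-intro {true} _ ty = ty

∧-elim : ∀ x {y} → T (x ∧ y) → T x × T y
∧-elim true ty = _ , ty

∨-introˡ : ∀ x {y} → T x → T (x ∨ y)
∨-introˡ true _ = _

∨-introʳ : ∀ x {y} → T y → T (x ∨ y)
∨-introʳ true _ = _
∨-introʳ false ty = ty

∨-elim : ∀ x {y} → T (x ∨ y) → T x ⊎ T y
∨-elim true _ = inj₁ _
∨-elim false ty = inj₂ ty

==-sound : ∀ {n} {a b : Fin n} → T (a == b) → a ≡ b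
==-sound {a = a} {b} = toWitness {a? = a ≟ᶠ b}

==-complete : ∀ {n} {a b : Fin n} → a ≡ b → T (a == b)
==-complete {a = a} {b} = fromWitness {a? = a ≟ᶠ b}

==⇒≡ : ∀ {n} {a b : Fin n} → (a == b) ≡ true → a ≡ b
==⇒≡ a=b = ==-sound (Equivalence.from T-≡ a=b)

∑-allFin-suc : ∀ {n} (f : Fin (suc n) → ℕ) → ∑ f (allFin (suc n)) ≡ f fzero + ∑ (λ i → f (fsuc i)) (allFin n)
∑-allFin-suc {n} f = cong (f fzero +_) (trans (cong (∑ f) (sym (map-tabulate id fsuc))) (∑-map f fsuc (allFin n)))

==-fsuc : ∀ {n} (a b : Fin n) → (fsuc a == fsuc b) ≡ (a == b)
==-fsuc a b with a ≟ᶠ b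
... | yes _ = refl
... | no _ = refl

∑-allFin-== : ∀ {n} (d : Fin n) → ∑ (λ b → 𝟙 (b == d)) (allFin n) ≡ 1
∑-allFin-== {suc n} fzero = trans (∑-allFin-suc {n} (λ b → 𝟙 (b == fzero))) (cong suc (∑-zero (allFin n)))
∑-allFin-== {suc n} (fsuc d) = begin
  ∑ (λ b → 𝟙 (b == fsuc d)) (allFin (suc n))  ≡⟨ ∑-allFin-suc (λ b → 𝟙 (b == fsuc d)) ⟩
  ∑ (λ b → 𝟙 (fsuc b == fsuc d)) (allFin n)   ≡⟨ ∑-cong (allFin n) (λ b _ → cong 𝟙 (==-fsuc b d)) ⟩
  ∑ (λ b → 𝟙 (b == d)) (allFin n)             ≡⟨ ∑-allFin-== d ⟩
  1                                           ∎

module _ {n : ℕ} (G : Graph n) where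

  Adj : Fin n → Fin n → Set
  Adj u v = T (adj G u v)

  Adj-sym : ∀ {u v} → Adj u v → Adj v u
  Adj-sym {u} {v} = subst T (adj-sym G u v)

  adj-loop : ∀ {x y} → x ≡ y → adj G x y ≡ false
  adj-loop {x} refl = irrefl G x

  Adj⇒≢ : ∀ {u v} → Adj u v → u ≢ v
  Adj⇒≢ uv u≡v = subst T (adj-loop u≡v) uv

  neighbours⇒internal : ∀ {u v w} → Adj u v → Adj u w → v ≢ w → Internal G u
  neighbours⇒internal {u} uv uw v≢w =
    subst (2 ≤_) (sym (count≡∑𝟙 (adj G u) (allFin n)))
      (∑𝟙-≥2 (adj G u) (allFin n) (∈-allFin _) (∈-allFin _) v≢w uv uw)

  internal⇒neighbours : ∀ {u} → Internal G u → ∃ λ v → ∃ λ w → v ≢ w × Adj u v × Adj u w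
  internal⇒neighbours {u} internal =
    ∑𝟙-≥2-witnesses (adj G u) (allFin n) (allFin⁺ n) (subst (2 ≤_) (count≡∑𝟙 (adj G u) (allFin n)) internal)

  isEdge? : (e : Fin n × Fin n) → Dec (toℕ (proj₁ e) < toℕ (proj₂ e) × adj G (proj₁ e) (proj₂ e) ≡ true)
  isEdge? (a , b) = (toℕ a <? toℕ b) ×-dec (adj G a b ≟ᵇ true)

  edge-ordered : ∀ {a b} → (a , b) ∈ edges G → toℕ a < toℕ b
  edge-ordered ab∈ = proj₁ (proj₂ (∈-filter⁻ isEdge? {xs = pairs n} ab∈))

  edge-adj : ∀ {a b} → (a , b) ∈ edges G → Adj a b
  edge-adj ab∈ = Equivalence.from T-≡ (proj₂ (proj₂ (∈-filter⁻ isEdge? {xs = pairs n} ab∈)))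

  edge-∈⁺ : ∀ {a b} → toℕ a < toℕ b → Adj a b → (a , b) ∈ edges G
  edge-∈⁺ {a} {b} a<b ab = ∈-filter⁺ isEdge? ab∈pairs (a<b , Equivalence.to T-≡ ab)
    where
      ab∈pairs : (a , b) ∈ pairs n
      ab∈pairs = ∈-concatMap⁺ (λ i → map (i ,_) (allFin n)) (lose (∈-allFin a) (∈-map⁺ (a ,_) (∈-allFin b)))

  Joins : Fin n × Fin n → Fin n → Fin n → Set
  Joins e u v = e ≡ (u , v) ⊎ e ≡ (v , u)

  edgeOf : ∀ {u v} → Adj u v → ∃ λ e → e ∈ edges G × Joins e u v
  edgeOf {u} {v} uv with <-cmp (toℕ u) (toℕ v)
  ... | tri< u<v _ _ = (u , v) , edge-∈⁺ u<v uv , inj₁ refl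
  ... | tri≈ _ u≡v _ = ⊥-elim (Adj⇒≢ uv (toℕ-injective u≡v))
  ... | tri> _ _ v<u = (v , u) , edge-∈⁺ v<u (Adj-sym uv) , inj₂ refl

  joins-distinct : ∀ {e f u v w} → Joins e u v → Joins f u w → u ≢ v → v ≢ w → e ≢ f
  joins-distinct (inj₁ refl) (inj₁ refl) _ v≢w refl = v≢w refl
  joins-distinct (inj₁ refl) (inj₂ refl) u≢v _ refl = u≢v refl
  joins-distinct (inj₂ refl) (inj₁ refl) u≢v _ refl = u≢v refl
  joins-distinct (inj₂ refl) (inj₂ refl) _ v≢w refl = v≢w refl

  joins⇒TAdj : ∀ {e u v} → Joins e u v → T (TAdj G (inj₁ u) (inj₂ e))
  joins⇒TAdj {u = u} (inj₁ refl) = ∨-introˡ (u == u) (==-complete refl)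
  joins⇒TAdj {u = u} {v} (inj₂ refl) = ∨-introʳ (u == v) (==-complete refl)

  ShareEnd : Fin n × Fin n → Fin n × Fin n → Set
  ShareEnd (a , b) (c , d) = a ≡ c ⊎ a ≡ d ⊎ b ≡ c ⊎ b ≡ d

  TAdj-edges⁻ : ∀ e f → T (TAdj G (inj₂ e) (inj₂ f)) → e ≢ f × ShareEnd e f
  TAdj-edges⁻ (a , b) (c , d) adjacent = e≢f , share (∨-elim (a == c) shared)
    where
      distinct : T (not ((a == c) ∧ (b == d)))
      distinct = proj₁ (∧-elim (not ((a == c) ∧ (b == d))) adjacent)
      shared : T ((a == c) ∨ (a == d) ∨ (b == c) ∨ (b == d))
      shared = proj₂ (∧-elim (not ((a == c) ∧ (b == d))) adjacent)
      e≢f : (a , b) ≢ (c , d)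
      e≢f refl = T-not distinct (∧-intro {a == a} {b == b} (==-complete refl) (==-complete refl))
      share : T (a == c) ⊎ T ((a == d) ∨ (b == c) ∨ (b == d)) → ShareEnd (a , b) (c , d)
      share (inj₁ a=c) = inj₁ (==-sound a=c)
      share (inj₂ rest) with ∨-elim (a == d) rest
      ... | inj₁ a=d = inj₂ (inj₁ (==-sound a=d))
      ... | inj₂ rest′ = inj₂ (inj₂ (map-⊎ ==-sound ==-sound (∨-elim (b == c) rest′)))

  TAdj-edges⁺ : ∀ e f → e ≢ f → ShareEnd e f → T (TAdj G (inj₂ e) (inj₂ f))
  TAdj-edges⁺ (a , b) (c , d) e≢f shared = ∧-intro (T-not⁺ different) (share shared)
    where
      different : ¬ T ((a == c) ∧ (b == d))
      different both = let (a=c , b=d) = ∧-elim (a == c) both in e≢f (cong₂ _,_ (==-sound a=c) (==-sound b=d))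
      share : ShareEnd (a , b) (c , d) → T ((a == c) ∨ (a == d) ∨ (b == c) ∨ (b == d))
      share (inj₁ refl) = ∨-introˡ (a == c) (==-complete refl)
      share (inj₂ (inj₁ refl)) = ∨-introʳ (a == c) (∨-introˡ (a == d) (==-complete refl))
      share (inj₂ (inj₂ (inj₁ refl))) = ∨-introʳ (a == c) (∨-introʳ (a == d) (∨-introˡ (b == c) (==-complete refl)))
      share (inj₂ (inj₂ (inj₂ refl))) = ∨-introʳ (a == c) (∨-introʳ (a == d) (∨-introʳ (b == c) (==-complete refl)))

  joins-shareEnd : ∀ {e f u v w} → Joins e u v → Joins f u w → ShareEnd e f
  joins-shareEnd (inj₁ refl) (inj₁ refl) = inj₁ refl
  joins-shareEnd (inj₁ refl) (inj₂ refl) = inj₂ (inj₁ refl)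
  joins-shareEnd (inj₂ refl) (inj₁ refl) = inj₂ (inj₂ (inj₁ refl))
  joins-shareEnd (inj₂ refl) (inj₂ refl) = inj₂ (inj₂ (inj₂ refl))

  meetingEdges⇒internal : ∀ {a b c d} → (a , b) ∈ edges G → (c , d) ∈ edges G →
    (a , b) ≢ (c , d) → ShareEnd (a , b) (c , d) → ∃[ u ] Internal G u
  meetingEdges⇒internal ab∈ cd∈ ab≢cd (inj₁ refl) =
    _ , neighbours⇒internal (edge-adj ab∈) (edge-adj cd∈) (λ { refl → ab≢cd refl })
  meetingEdges⇒internal ab∈ cd∈ _ (inj₂ (inj₁ refl)) =
    _ , neighbours⇒internal (edge-adj ab∈) (Adj-sym (edge-adj cd∈)) (λ { refl → <-asym (edge-ordered ab∈) (edge-ordered cd∈) })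
  meetingEdges⇒internal ab∈ cd∈ _ (inj₂ (inj₂ (inj₁ refl))) =
    _ , neighbours⇒internal (Adj-sym (edge-adj ab∈)) (edge-adj cd∈) (λ { refl → <-asym (edge-ordered ab∈) (edge-ordered cd∈) })
  meetingEdges⇒internal ab∈ cd∈ ab≢cd (inj₂ (inj₂ (inj₂ refl))) =
    _ , neighbours⇒internal (Adj-sym (edge-adj ab∈)) (Adj-sym (edge-adj cd∈)) (λ { refl → ab≢cd refl })

  isTriangle : TElem n × TElem n × TElem n → Bool
  isTriangle (x , y , z) = TAdj G x y ∧ TAdj G y z ∧ TAdj G x z

  triangle : TElem n × TElem n × TElem n → ℕ
  triangle t = 𝟙 (isTriangle t)

  V E : List (TElem n)
  V = map inj₁ (allFin n)
  E = map inj₂ (edges G)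

  #VVV #VVE #VEE #EEE : ℕ
  #VVV = ∑ triangle (triples V)
  #VVE = ∑₂₁ triangle V E
  #VEE = ∑₁₂ triangle V E
  #EEE = ∑ triangle (triples E)

  hT-split : hT G ≡ #VVV + #VVE + #VEE + #EEE
  hT-split = trans (count≡∑𝟙 isTriangle (triples (TVertices G))) (∑-triples-++ triangle V E)

  vertexPairTriangle : ∀ {c d} → c ≢ d → Adj c d → ∀ a b →
    triangle (inj₁ a , inj₁ b , inj₂ (c , d)) ≡ 𝟙 (a == c) * 𝟙 (b == d) + 𝟙 (a == d) * 𝟙 (b == c)
  vertexPairTriangle {c} {d} c≢d cd a b
    with a == c in a=c | a == d in a=d | b == c in b=c | b == d in b=d
  ... | true  | true  | _     | _     = ⊥-elim (c≢d (trans (sym (==⇒≡ a=c)) (==⇒≡ a=d)))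
  ... | _     | _     | true  | true  = ⊥-elim (c≢d (trans (sym (==⇒≡ b=c)) (==⇒≡ b=d)))
  ... | true  | false | true  | false = cong (λ x → 𝟙 (x ∧ true)) (adj-loop (trans (==⇒≡ a=c) (sym (==⇒≡ b=c))))
  ... | false | true  | false | true  = cong (λ x → 𝟙 (x ∧ true)) (adj-loop (trans (==⇒≡ a=d) (sym (==⇒≡ b=d))))
  ... | true  | false | false | true  = cong (λ x → 𝟙 (x ∧ true)) (Equivalence.to T-≡ (subst₂ Adj (sym (==⇒≡ a=c)) (sym (==⇒≡ b=d)) cd))
  ... | false | true  | true  | false = cong (λ x → 𝟙 (x ∧ true)) (Equivalence.to T-≡ (subst₂ Adj (sym (==⇒≡ a=d)) (sym (==⇒≡ b=c)) (Adj-sym cd)))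
  ... | true  | false | false | false = cong 𝟙 (∧-zeroʳ (adj G a b))
  ... | false | true  | false | false = cong 𝟙 (∧-zeroʳ (adj G a b))
  ... | false | false | true  | false = cong 𝟙 (∧-zeroʳ (adj G a b))
  ... | false | false | false | true  = cong 𝟙 (∧-zeroʳ (adj G a b))
  ... | false | false | false | false = cong 𝟙 (∧-zeroʳ (adj G a b))

  VVE-at-edge : ∀ {c d} → (c , d) ∈ edges G →
    ∑ (λ p → triangle (proj₁ p , proj₂ p , inj₂ (c , d))) (choose2 V) ≡ 1
  VVE-at-edge {c} {d} cd∈ = *-cancelˡ-≡ _ 1 2 (begin
    2 * ∑ (λ p → triangle (proj₁ p , proj₂ p , inj₂ (c , d))) (choose2 V)
      ≡⟨ cong (2 *_) (trans (cong (∑ _) (choose2-map inj₁ (allFin n))) (∑-map _ _ (choose2 (allFin n)))) ⟩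
    2 * ∑ (λ p → g (proj₁ p) (proj₂ p)) (choose2 (allFin n))
      ≡⟨ ∑-choose2-symmetric g g-sym g-diag (allFin n) ⟩
    ∑ (λ a → ∑ (g a) (allFin n)) (allFin n)
      ≡⟨ ∑-cong (allFin n) (λ a _ → row a) ⟩
    ∑ (λ a → 𝟙 (a == c) + 𝟙 (a == d)) (allFin n)
      ≡⟨ ∑-+ (λ a → 𝟙 (a == c)) (λ a → 𝟙 (a == d)) (allFin n) ⟩
    ∑ (λ a → 𝟙 (a == c)) (allFin n) + ∑ (λ a → 𝟙 (a == d)) (allFin n)
      ≡⟨ cong₂ _+_ (∑-allFin-== c) (∑-allFin-== d) ⟩
    2 * 1 ∎)
    where
      g : Fin n → Fin n → ℕ
      g a b = triangle (inj₁ a , inj₁ b , inj₂ (c , d))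
      g-sym : ∀ a b → g a b ≡ g b a
      g-sym a b = cong 𝟙 (cong₂ (λ x y → x ∧ y) (adj-sym G a b) (∧-comm ((b == c) ∨ (b == d)) ((a == c) ∨ (a == d))))
      g-diag : ∀ a → g a a ≡ 0
      g-diag a = cong (λ x → 𝟙 (x ∧ TAdj G (inj₁ a) (inj₂ (c , d)) ∧ TAdj G (inj₁ a) (inj₂ (c , d)))) (irrefl G a)
      row : ∀ a → ∑ (g a) (allFin n) ≡ 𝟙 (a == c) + 𝟙 (a == d)
      row a = begin
        ∑ (g a) (allFin n)
          ≡⟨ ∑-cong (allFin n) (λ b _ → vertexPairTriangle (Adj⇒≢ (edge-adj cd∈)) (edge-adj cd∈) a b) ⟩
        ∑ (λ b → 𝟙 (a == c) * 𝟙 (b == d) + 𝟙 (a == d) * 𝟙 (b == c)) (allFin n)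
          ≡⟨ ∑-+ (λ b → 𝟙 (a == c) * 𝟙 (b == d)) (λ b → 𝟙 (a == d) * 𝟙 (b == c)) (allFin n) ⟩
        ∑ (λ b → 𝟙 (a == c) * 𝟙 (b == d)) (allFin n) + ∑ (λ b → 𝟙 (a == d) * 𝟙 (b == c)) (allFin n)
          ≡⟨ cong₂ _+_ (∑-* (𝟙 (a == c)) (λ b → 𝟙 (b == d)) (allFin n)) (∑-* (𝟙 (a == d)) (λ b → 𝟙 (b == c)) (allFin n)) ⟩
        𝟙 (a == c) * ∑ (λ b → 𝟙 (b == d)) (allFin n) + 𝟙 (a == d) * ∑ (λ b → 𝟙 (b == c)) (allFin n)
          ≡⟨ cong₂ (λ x y → 𝟙 (a == c) * x + 𝟙 (a == d) * y) (∑-allFin-== d) (∑-allFin-== c) ⟩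
        𝟙 (a == c) * 1 + 𝟙 (a == d) * 1
          ≡⟨ cong₂ _+_ (*-identityʳ (𝟙 (a == c))) (*-identityʳ (𝟙 (a == d))) ⟩
        𝟙 (a == c) + 𝟙 (a == d) ∎

  #VVE≡|E| : #VVE ≡ numEdges G
  #VVE≡|E| = begin
    ∑ (λ z → ∑ (λ p → triangle (proj₁ p , proj₂ p , z)) (choose2 V)) (map inj₂ (edges G))
      ≡⟨ ∑-map _ inj₂ (edges G) ⟩
    ∑ (λ e → ∑ (λ p → triangle (proj₁ p , proj₂ p , inj₂ e)) (choose2 V)) (edges G)
      ≡⟨ ∑-cong (edges G) (λ _ e∈ → VVE-at-edge e∈) ⟩
    ∑ (λ _ → 1) (edges G)
      ≡⟨ ∑-one (edges G) ⟩
    numEdges G ∎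

  triangle-sides : ∀ x y z → T (isTriangle (x , y , z)) →
    T (TAdj G x y) × T (TAdj G y z) × T (TAdj G x z)
  triangle-sides x y z xyz =
    let (xy , yz∧xz) = ∧-elim (TAdj G x y) xyz in xy , ∧-elim (TAdj G y z) yz∧xz

  adjacentEdges⇒internal : ∀ {y z} → y ∈ E → z ∈ E → T (TAdj G y z) → ∃[ u ] Internal G u
  adjacentEdges⇒internal y∈ z∈ yz with ∈-map⁻ inj₂ y∈ | ∈-map⁻ inj₂ z∈
  ... | ab , ab∈ , refl | cd , cd∈ , refl =
    let (ab≢cd , share) = TAdj-edges⁻ ab cd yz in meetingEdges⇒internal ab∈ cd∈ ab≢cd share

  VVV-positive⇒internal : 0 < #VVV → ∃[ u ] Internal G u
  VVV-positive⇒internal pos with ∑-positive triangle (triples V) pos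
  ... | (x , y , z) , xyz∈ , xyz with triples-∈ V xyz∈
  ... | x∈ , y∈ , z∈ with ∈-map⁻ inj₁ x∈ | ∈-map⁻ inj₁ y∈ | ∈-map⁻ inj₁ z∈
  ... | a , _ , refl | b , _ , refl | c , _ , refl =
    let (ab , bc , ac) = triangle-sides x y z (𝟙-positive xyz) in a , neighbours⇒internal ab ac (Adj⇒≢ bc)

  VEE-positive⇒internal : 0 < #VEE → ∃[ u ] Internal G u
  VEE-positive⇒internal pos with ∑-positive (λ x → ∑ (λ p → triangle (x , p)) (choose2 E)) V pos
  ... | x , _ , x-pos with ∑-positive (λ p → triangle (x , p)) (choose2 E) x-pos
  ... | (y , z) , yz∈ , xyz =
    let (y∈ , z∈) = choose2-∈ E yz∈
    in adjacentEdges⇒internal y∈ z∈ (proj₁ (proj₂ (triangle-sides x y z (𝟙-positive xyz))))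

  EEE-positive⇒internal : 0 < #EEE → ∃[ u ] Internal G u
  EEE-positive⇒internal pos with ∑-positive triangle (triples E) pos
  ... | (x , y , z) , xyz∈ , xyz =
    let (x∈ , y∈ , _) = triples-∈ E xyz∈
    in adjacentEdges⇒internal x∈ y∈ (proj₁ (triangle-sides x y z (𝟙-positive xyz)))

  star : ∀ {u v w e f} → Joins e u v → Joins f u w → e ≢ f → T (isTriangle (inj₁ u , inj₂ e , inj₂ f))
  star {e = e} {f} u–v u–w e≢f =
    ∧-intro (joins⇒TAdj u–v) (∧-intro (TAdj-edges⁺ e f e≢f (joins-shareEnd u–v u–w)) (joins⇒TAdj u–w))

  VEE-triangle⇒positive : ∀ {u y z} → (y , z) ∈ choose2 E → T (isTriangle (inj₁ u , y , z)) → 0 < #VEE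
  VEE-triangle⇒positive {u} yz∈ uyz =
    ≤-trans (𝟙-true uyz)
      (≤-trans (∑-≥-term (λ p → triangle (inj₁ u , p)) yz∈)
               (∑-≥-term (λ x → ∑ (λ p → triangle (x , p)) (choose2 E)) (∈-map⁺ inj₁ (∈-allFin u))))

  edgesAt⇒VEE-positive : ∀ {u v w e f} → e ∈ edges G → f ∈ edges G →
    Joins e u v → Joins f u w → e ≢ f → 0 < #VEE
  edgesAt⇒VEE-positive {u} e∈ f∈ u–v u–w e≢f
    with choose2-complete E (∈-map⁺ inj₂ e∈) (∈-map⁺ inj₂ f∈) (λ { refl → e≢f refl })
  ... | inj₁ ef∈ = VEE-triangle⇒positive {u} ef∈ (star u–v u–w e≢f)
  ... | inj₂ fe∈ = VEE-triangle⇒positive {u} fe∈ (star u–w u–v (λ f≡e → e≢f (sym f≡e)))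

  internal⇒VEE-positive : ∀ {u} → Internal G u → 0 < #VEE
  internal⇒VEE-positive internal with internal⇒neighbours internal
  ... | v , w , v≢w , uv , uw with edgeOf uv | edgeOf uw
  ... | e , e∈ , u–v | f , f∈ , u–w = edgesAt⇒VEE-positive e∈ f∈ u–v u–w (joins-distinct u–v u–w (Adj⇒≢ uv) v≢w)

exceeds⇒positive : ∀ a m b c → m < a + m + b + c → 0 < a ⊎ 0 < b ⊎ 0 < c
exceeds⇒positive (suc _) _ _ _ _ = inj₁ (s≤s z≤n)
exceeds⇒positive zero _ (suc _) _ _ = inj₂ (inj₁ (s≤s z≤n))
exceeds⇒positive zero _ zero (suc _) _ = inj₂ (inj₂ (s≤s z≤n))
exceeds⇒positive zero m zero zero m<m+0+0 =
  ⊥-elim (<-irrefl refl (subst (m <_) (trans (+-identityʳ (m + 0)) (+-identityʳ m)) m<m+0+0))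

positive⇒exceeds : ∀ a m b c → 0 < b → m < a + m + b + c
positive⇒exceeds a m b c 0<b =
  <-≤-trans (m<m+n m 0<b) (≤-trans (+-monoˡ-≤ b (m≤n+m m a)) (m≤m+n (a + m + b) c))

corollary2p11 : ∀ {n : ℕ} (G : Graph n) → Connected G →
    (numEdges G < hT G) ⇔ (∃[ u ] Internal G u)
corollary2p11 G _ = mk⇔ exceeds⇒internal internal⇒exceeds
  where
    split : hT G ≡ #VVV G + numEdges G + #VEE G + #EEE G
    split = trans (hT-split G) (cong (λ k → #VVV G + k + #VEE G + #EEE G) (#VVE≡|E| G))

    exceeds⇒internal : numEdges G < hT G → ∃[ u ] Internal G u
    exceeds⇒internal exceeds
      with exceeds⇒positive (#VVV G) (numEdges G) (#VEE G) (#EEE G) (subst (numEdges G <_) split exceeds)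
    ... | inj₁ vvv = VVV-positive⇒internal G vvv
    ... | inj₂ (inj₁ vee) = VEE-positive⇒internal G vee
    ... | inj₂ (inj₂ eee) = EEE-positive⇒internal G eee

    internal⇒exceeds : ∃[ u ] Internal G u → numEdges G < hT G
    internal⇒exceeds (_ , internal) =
      subst (numEdges G <_) (sym split)
        (positive⇒exceeds (#VVV G) (numEdges G) (#VEE G) (#EEE G) (internal⇒VEE-positive G internal))
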